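{- Consider the single-machine instance and the linear program in the context, where $T$ is at least the time by which some optimal schedule completes all its jobs. Then the optimal value of the linear program is at most $\mathsf{Opt}$, the optimal sum of flow times.
   Context: Instance: a single machine and $n$ jobs; job $j$ has integer release date $r_j$ and integer processing time $p_j>0$; all profits are $1$. Given $\Pi>0$, one selects a set $S$ of jobs with $|S|\ge\Pi$ and a preemptive schedule of $S$ (no processing before release dates) minimizing $\sum_{j\in S}(C_j-r_j)$; $\mathsf{Opt}$ denotes this minimum. Let $\widetilde p_j$ be $p_j$ rounded up to the next power of $2$. The linear program has variables $x_{jt}$ ($0\le t\le T$), $y_j$, $f_j$ and is: minimize $\sum_j f_j$ subject to (1) $f_j=\sum_{t=0}^T\big(\frac{x_{jt}}{\widetilde p_j}(t+\tfrac12-r_j)+\frac{x_{jt}}2\big)$ for all $j$; (2) $p_jy_j=\sum_{t=0}^Tx_{jt}$ for all $j$; (3) $\sum_jx_{jt}\le1$ for all $t$; (4) $\sum_jy_j\ge\Pi$; (5) $x_{jt}=0$ whenever $t<r_j$; (6) $x_{jt}\ge0$, $0\le y_j\le1$. -}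

module Defs where

open import Data.Nat as ℕ using (ℕ; zero; suc; _∸_; _^_)
open import Data.Nat.Properties using (m^n≢0)
open import Data.Nat.Logarithm using (⌈log₂_⌉)
open import Data.Fin using (Fin; _≟_)
import Data.Fin as Fin
open import Data.Fin.Subset using (Subset; _∈_; ∣_∣)
open import Data.Vec using (lookup)
open import Data.Bool using (if_then_else_)
open import Data.Maybe using (Maybe; just; nothing)
open import Data.Integer using (+_)
open import Data.Rational using (ℚ; _/_; ½; 0ℚ; 1ℚ)
import Data.Rational as ℚ
open import Data.Product using (_×_)
open import Relation.Binary.PropositionalEquality using (_≡_)
open import Relation.Nullary using (yes; no)

Σℕ : ∀ {n} → (Fin n → ℕ) → ℕ
Σℕ {zero}  f = 0
Σℕ {suc n} f = f Fin.zero ℕ.+ Σℕ (λ i → f (Fin.suc i))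

Σℚ : ∀ {n} → (Fin n → ℚ) → ℚ
Σℚ {zero}  f = 0ℚ
Σℚ {suc n} f = f Fin.zero ℚ.+ Σℚ (λ i → f (Fin.suc i))

Σ<ℚ : ℕ → (ℕ → ℚ) → ℚ
Σ<ℚ zero    g = 0ℚ
Σ<ℚ (suc m) g = Σ<ℚ m g ℚ.+ g m

⟦_⟧ : ℕ → ℚ
⟦ k ⟧ = + k / 1

-- Instance: n jobs, release dates r, processing times p (positivity is
-- a hypothesis of the theorem).  Time is slotted: slot t is [t, t+1).

-- A preemptive schedule of a selected set S of jobs:
-- slot t runs job (just j) or is idle (nothing); C j is the completion time.
record Schedule (n : ℕ) : Set where
  field
    S    : Subset n
    slot : ℕ → Maybe (Fin n)
    C    : Fin n → ℕ

count : ∀ {n} → (ℕ → Maybe (Fin n)) → Fin n → ℕ → ℕ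
count σ j zero = 0
count σ j (suc m) with σ m
... | nothing = count σ j m
... | just i with i ≟ j
...   | yes _ = suc (count σ j m)
...   | no  _ = count σ j m

record Feasible {n : ℕ} (r p : Fin n → ℕ) (Π : ℚ) (σ : Schedule n) : Set where
  open Schedule σ
  field
    onlySelected : ∀ t j → slot t ≡ just j → j ∈ S
    afterRelease : ∀ t j → slot t ≡ just j → r j ℕ.≤ t
    beforeCompl  : ∀ t j → slot t ≡ just j → t ℕ.< C j
    fullAmount   : ∀ j → j ∈ S → count slot j (C j) ≡ p j
    lastSlot     : ∀ j → j ∈ S → slot (C j ∸ 1) ≡ just j
    enoughJobs   : Π ℚ.≤ ⟦ ∣ S ∣ ⟧

flowTime : ∀ {n} → (r : Fin n → ℕ) → Schedule n → ℕ
flowTime r σ = Σℕ (λ j → if lookup (Schedule.S σ) j then Schedule.C σ j ∸ r j else 0)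

Optimal : ∀ {n} → (r p : Fin n → ℕ) → ℚ → Schedule n → Set
Optimal r p Π σ = Feasible r p Π σ × (∀ σ′ → Feasible r p Π σ′ → flowTime r σ ℕ.≤ flowTime r σ′)

CompletesBy : ∀ {n} → Schedule n → ℕ → Set
CompletesBy σ T = ∀ j → j ∈ Schedule.S σ → Schedule.C σ j ℕ.≤ T

expo : ℕ → ℕ
expo q = ⌈log₂ q ⌉

p̃ : ℕ → ℕ
p̃ q = 2 ^ expo q

inv-p̃ : ℕ → ℚ
inv-p̃ q = _/_ (+ 1) (p̃ q) {{m^n≢0 2 (expo q)}}

-- an LP solution: x j t (only t ∈ {0..T} are used), y j, f j
record LPSol (n : ℕ) : Set where
  field
    x : Fin n → ℕ → ℚ
    y : Fin n → ℚ
    f : Fin n → ℚ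

record LPFeasible {n : ℕ} (r p : Fin n → ℕ) (Π : ℚ) (T : ℕ) (s : LPSol n) : Set where
  open LPSol s
  field
    c1 : ∀ j → f j ≡ Σ<ℚ (suc T) (λ t →
            (x j t ℚ.* inv-p̃ (p j)) ℚ.* ((⟦ t ⟧ ℚ.+ ½) ℚ.- ⟦ r j ⟧) ℚ.+ x j t ℚ.* ½)
    c2 : ∀ j → ⟦ p j ⟧ ℚ.* y j ≡ Σ<ℚ (suc T) (λ t → x j t)
    c3 : ∀ t → t ℕ.≤ T → Σℚ (λ j → x j t) ℚ.≤ 1ℚ
    c4 : Π ℚ.≤ Σℚ y
    c5 : ∀ j t → t ℕ.≤ T → t ℕ.< r j → x j t ≡ 0ℚ
    c6x : ∀ j t → t ℕ.≤ T → 0ℚ ℚ.≤ x j t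
    c6y : ∀ j → 0ℚ ℚ.≤ y j × y j ℚ.≤ 1ℚ

LPObjective : ∀ {n} → LPSol n → ℚ
LPObjective s = Σℚ (LPSol.f s)

{-# OPTIONS --safe #-}
-- The schedule induces the LP solution x_jt = [slot t runs j], y_j = [j ∈ S], for which the
-- constraints are immediate. A selected job with release r, completion C and processing time p
-- occupies p distinct slots of [r, C), so the sum of 2(t − r) + 1 over them is at most its value
-- on the last p slots, 2p(C − r) − p². Hence its LP cost f_j is at most ((2p(C − r) − p²)/p̃ + p)/2,
-- which is at most C − r because (p̃ − p)(2(C − r) − p) ≥ 0, as p ≤ p̃ and p ≤ C − r.
module Submission where

open import Defs
open import Data.Nat using (ℕ; _<_)
open import Data.Fin using (Fin)
open import Data.Rational using (ℚ; 0ℚ)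
import Data.Rational as ℚ
open import Data.Product using (Σ; _×_)

open import Level using (0ℓ)
open import Data.Bool using (true; false; if_then_else_)
open import Data.Empty using (⊥-elim)
open import Data.Fin using (zero; suc; _≟_)
open import Data.Fin.Subset using (Subset; _∈_; ∣_∣)
open import Data.Integer as ℤ using (+_)
import Data.Integer.Properties as ℤP
open import Data.Maybe using (Maybe; just; nothing)
open import Data.Nat using (zero; suc; _+_; _*_; _∸_; _^_; _≤_; z≤n; s≤s; NonZero; ⌊_/2⌋; ⌈_/2⌉)
import Data.Nat.Properties as ℕP
open import Data.Nat.Induction using (<-wellFounded)
open import Data.Nat.Logarithm using (⌈log₂_⌉)
open import Data.Nat.Logarithm.Core using (⌈log2⌉)
open import Data.Nat.Tactic.RingSolver using (solve)
import Data.Nat.Coprimality as Coprime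
open import Data.Product using (_,_; proj₁; proj₂)
open import Data.Rational using (mkℚ; 1ℚ; ½; _/_)
import Data.Rational.Properties as ℚP
open import Data.Sum using (_⊎_; inj₁; inj₂)
open import Data.List using ([]; _∷_)
open import Data.Vec as Vec using (lookup)
open import Data.Vec.Properties using (lookup⇒[]=; []=⇒lookup)
open import Induction.WellFounded using (Acc; acc)
open import Relation.Binary.PropositionalEquality
open import Relation.Nullary using (yes; no)
open import Relation.Nullary.Decidable using (dec⇒maybe)
open import Tactic.RingSolver using (solve-∀)
open import Tactic.RingSolver.Core.AlmostCommutativeRing using (AlmostCommutativeRing; fromCommutativeRing)

ℚ-ring : AlmostCommutativeRing 0ℓ 0ℓ
ℚ-ring = fromCommutativeRing ℚP.+-*-commutativeRing (λ x → dec⇒maybe (0ℚ ℚP.≟ x))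

⟦⟧≡mkℚ : ∀ k → ⟦ k ⟧ ≡ mkℚ (+ k) 0 (Coprime.sym (Coprime.1-coprimeTo k))
⟦⟧≡mkℚ k = ℚP.normalize-coprime (Coprime.sym (Coprime.1-coprimeTo k))

⟦⟧-homo-+ : ∀ a b → ⟦ a + b ⟧ ≡ ⟦ a ⟧ ℚ.+ ⟦ b ⟧
⟦⟧-homo-+ a b = begin
  + (a + b) / 1                       ≡⟨ ℚP./-cong numerator refl ⟩
  (+ a ℤ.* + 1 ℤ.+ + b ℤ.* + 1) / 1   ≡⟨ cong₂ ℚ._+_ (⟦⟧≡mkℚ a) (⟦⟧≡mkℚ b) ⟨
  ⟦ a ⟧ ℚ.+ ⟦ b ⟧                     ∎
  where
  open ≡-Reasoning
  numerator : + (a + b) ≡ + a ℤ.* + 1 ℤ.+ + b ℤ.* + 1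
  numerator = trans (ℤP.pos-+ a b) (sym (cong₂ ℤ._+_ (ℤP.*-identityʳ (+ a)) (ℤP.*-identityʳ (+ b))))

⟦⟧-homo-* : ∀ a b → ⟦ a * b ⟧ ≡ ⟦ a ⟧ ℚ.* ⟦ b ⟧
⟦⟧-homo-* a b = begin
  + (a * b) / 1       ≡⟨ ℚP./-cong (ℤP.pos-* a b) refl ⟩
  (+ a ℤ.* + b) / 1   ≡⟨ cong₂ ℚ._*_ (⟦⟧≡mkℚ a) (⟦⟧≡mkℚ b) ⟨
  ⟦ a ⟧ ℚ.* ⟦ b ⟧     ∎
  where open ≡-Reasoning

⟦⟧-mono-≤ : ∀ {a b} → a ≤ b → ⟦ a ⟧ ℚ.≤ ⟦ b ⟧
⟦⟧-mono-≤ {a} {b} a≤b rewrite ⟦⟧≡mkℚ a | ⟦⟧≡mkℚ b =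
  ℚ.*≤* (subst₂ ℤ._≤_ (sym (ℤP.*-identityʳ (+ a))) (sym (ℤP.*-identityʳ (+ b))) (ℤ.+≤+ a≤b))

1/n*n≡1 : ∀ n .{{_ : NonZero n}} → (+ 1 / n) ℚ.* ⟦ n ⟧ ≡ 1ℚ
1/n*n≡1 (suc k) = begin
  (+ 1 / suc k) ℚ.* ⟦ suc k ⟧
    ≡⟨ cong₂ ℚ._*_ (ℚP.normalize-coprime (Coprime.1-coprimeTo (suc k))) (⟦⟧≡mkℚ (suc k)) ⟩
  ℚ.1/ q ℚ.* q
    ≡⟨ ℚP.*-inverseˡ q ⟩
  1ℚ ∎
  where
  open ≡-Reasoning
  q : ℚ
  q = mkℚ (+ suc k) 0 (Coprime.sym (Coprime.1-coprimeTo (suc k)))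

Σ<ℕ : ℕ → (ℕ → ℕ) → ℕ
Σ<ℕ zero    g = 0
Σ<ℕ (suc m) g = Σ<ℕ m g + g m

Σ<ℚ-⟦⟧ : ∀ m (g : ℕ → ℕ) → Σ<ℚ m (λ t → ⟦ g t ⟧) ≡ ⟦ Σ<ℕ m g ⟧
Σ<ℚ-⟦⟧ zero    g = refl
Σ<ℚ-⟦⟧ (suc m) g = trans (cong (ℚ._+ ⟦ g m ⟧) (Σ<ℚ-⟦⟧ m g)) (sym (⟦⟧-homo-+ (Σ<ℕ m g) (g m)))

Σℚ-⟦⟧ : ∀ {n} (g : Fin n → ℕ) → Σℚ (λ j → ⟦ g j ⟧) ≡ ⟦ Σℕ g ⟧
Σℚ-⟦⟧ {zero}  g = refl
Σℚ-⟦⟧ {suc n} g = trans (cong (⟦ g zero ⟧ ℚ.+_) (Σℚ-⟦⟧ (λ j → g (suc j))))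
                        (sym (⟦⟧-homo-+ (g zero) (Σℕ (λ j → g (suc j)))))

Σℚ-mono-≤ : ∀ {n} {f g : Fin n → ℚ} → (∀ j → f j ℚ.≤ g j) → Σℚ f ℚ.≤ Σℚ g
Σℚ-mono-≤ {zero}  f≤g = ℚP.≤-refl
Σℚ-mono-≤ {suc n} f≤g = ℚP.+-mono-≤ (f≤g zero) (Σℚ-mono-≤ (λ j → f≤g (suc j)))

Σℕ-cong : ∀ {n} {f g : Fin n → ℕ} → (∀ j → f j ≡ g j) → Σℕ f ≡ Σℕ g
Σℕ-cong {zero}  f≗g = refl
Σℕ-cong {suc n} f≗g = cong₂ _+_ (f≗g zero) (Σℕ-cong (λ j → f≗g (suc j)))

Σℕ-zero : ∀ n → Σℕ {n} (λ _ → 0) ≡ 0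
Σℕ-zero zero    = refl
Σℕ-zero (suc n) = Σℕ-zero n

Σ<ℕ-stable : ∀ (g : ℕ → ℕ) {m m′} → m ≤ m′ → (∀ t → m ≤ t → g t ≡ 0) → Σ<ℕ m′ g ≡ Σ<ℕ m g
Σ<ℕ-stable g {m′ = zero} z≤n _ = refl
Σ<ℕ-stable g {m} {suc m′} m≤1+m′ vanish with ℕP.m≤n⇒m<n∨m≡n m≤1+m′
... | inj₂ refl = refl
... | inj₁ (s≤s m≤m′) = begin
  Σ<ℕ m′ g + g m′   ≡⟨ cong₂ _+_ (Σ<ℕ-stable g m≤m′ vanish) (vanish m′ m≤m′) ⟩
  Σ<ℕ m g + 0       ≡⟨ ℕP.+-identityʳ (Σ<ℕ m g) ⟩
  Σ<ℕ m g           ∎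
  where open ≡-Reasoning

runs : ∀ {n} → Maybe (Fin n) → Fin n → ℕ
runs nothing  j = 0
runs (just i) j with i ≟ j
... | yes _ = 1
... | no  _ = 0

runs-01 : ∀ {n} (o : Maybe (Fin n)) j → runs o j ≡ 0 ⊎ (runs o j ≡ 1 × o ≡ just j)
runs-01 nothing  j = inj₁ refl
runs-01 (just i) j with i ≟ j
... | yes refl = inj₂ (refl , refl)
... | no  _    = inj₁ refl

runs-idle : ∀ {n} {o : Maybe (Fin n)} {j} → o ≢ just j → runs o j ≡ 0
runs-idle {o = o} {j} o≢j with runs-01 o j
... | inj₁ idle          = idle
... | inj₂ (_ , o≡just) = ⊥-elim (o≢j o≡just)

runs-suc : ∀ {n} (i j : Fin n) → runs (just (suc i)) (suc j) ≡ runs (just i) j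
runs-suc i j with i ≟ j
... | yes _ = refl
... | no  _ = refl

Σℕ-runs-just : ∀ {n} (i : Fin n) → Σℕ (runs (just i)) ≡ 1
Σℕ-runs-just {suc n} zero    = cong suc (Σℕ-zero n)
Σℕ-runs-just {suc n} (suc i) = trans (Σℕ-cong (runs-suc i)) (Σℕ-runs-just i)

Σℕ-runs≤1 : ∀ {n} (o : Maybe (Fin n)) → Σℕ (runs o) ≤ 1
Σℕ-runs≤1 {n} nothing = ℕP.≤-trans (ℕP.≤-reflexive (Σℕ-zero n)) z≤n
Σℕ-runs≤1 (just i) = ℕP.≤-reflexive (Σℕ-runs-just i)

count≡Σ<ℕ-runs : ∀ {n} (slot : ℕ → Maybe (Fin n)) j m → count slot j m ≡ Σ<ℕ m (λ t → runs (slot t) j)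
count≡Σ<ℕ-runs slot j zero = refl
count≡Σ<ℕ-runs slot j (suc m) with slot m
... | nothing = trans (count≡Σ<ℕ-runs slot j m) (sym (ℕP.+-identityʳ _))
... | just i with i ≟ j
...   | yes _ = trans (cong suc (count≡Σ<ℕ-runs slot j m)) (ℕP.+-comm 1 _)
...   | no  _ = trans (count≡Σ<ℕ-runs slot j m) (sym (ℕP.+-identityʳ _))

indicator : ∀ {n} → Subset n → Fin n → ℕ
indicator S j = if lookup S j then 1 else 0

Σℕ-indicator : ∀ {n} (S : Subset n) → Σℕ (indicator S) ≡ ∣ S ∣
Σℕ-indicator Vec.[]          = refl
Σℕ-indicator (true Vec.∷ S)  = cong suc (Σℕ-indicator S)
Σℕ-indicator (false Vec.∷ S) = Σℕ-indicator S

indicator≤1 : ∀ {n} (S : Subset n) j → indicator S j ≤ 1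
indicator≤1 S j with lookup S j
... | true  = ℕP.≤-refl
... | false = z≤n

-- twice the LP's delay t + ½ − r of slot t
flowWeight : ℕ → ℕ → ℕ
flowWeight r t = suc (2 * (t ∸ r))

Occupancy : ℕ → (ℕ → ℕ) → Set
Occupancy r a = ∀ t → a t ≡ 0 ⊎ (a t ≡ 1 × r ≤ t)

-- The two induction steps of occupancy-bound, in the shape the sums take after the
-- slot indicator is rewritten to 0 or 1.
idle-step : ∀ W N d d′ → d ≤ d′ → W + N * N ≤ 2 * N * d →
            W + 0 + (N + 0) * (N + 0) ≤ 2 * (N + 0) * d′
idle-step W N d d′ d≤d′ W-bound = begin
  W + 0 + (N + 0) * (N + 0)   ≡⟨ solve (W ∷ N ∷ []) ⟩
  W + N * N                   ≤⟨ W-bound ⟩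
  2 * N * d                   ≤⟨ ℕP.*-monoʳ-≤ (2 * N) d≤d′ ⟩
  2 * N * d′                  ≡⟨ solve (N ∷ d′ ∷ []) ⟩
  2 * (N + 0) * d′            ∎
  where open ℕP.≤-Reasoning

occupied-step : ∀ W N d → W + N * N ≤ 2 * N * d →
                W + 1 * suc (2 * d) + (N + 1) * (N + 1) ≤ 2 * (N + 1) * suc d
occupied-step W N d W-bound = begin
  W + 1 * suc (2 * d) + (N + 1) * (N + 1)   ≡⟨ solve (W ∷ N ∷ d ∷ []) ⟩
  W + N * N + 2 * (N + d + 1)               ≤⟨ ℕP.+-monoˡ-≤ (2 * (N + d + 1)) W-bound ⟩
  2 * N * d + 2 * (N + d + 1)               ≡⟨ solve (N ∷ d ∷ []) ⟩
  2 * (N + 1) * suc d                       ∎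
  where open ℕP.≤-Reasoning

module _ {r : ℕ} {a : ℕ → ℕ} (occ : Occupancy r a) where

  occupancy-bound : ∀ m →
    Σ<ℕ m (λ t → a t * flowWeight r t) + Σ<ℕ m a * Σ<ℕ m a ≤ 2 * Σ<ℕ m a * (m ∸ r) × Σ<ℕ m a ≤ m ∸ r
  occupancy-bound zero = z≤n , z≤n
  occupancy-bound (suc m) with occ m | occupancy-bound m
  ... | inj₁ a≡0 | W-bound , N-bound rewrite a≡0 =
      idle-step (Σ<ℕ m (λ t → a t * flowWeight r t)) (Σ<ℕ m a) _ _ later W-bound ,
      ℕP.≤-trans (ℕP.≤-reflexive (ℕP.+-identityʳ (Σ<ℕ m a))) (ℕP.≤-trans N-bound later)
    where
    later : m ∸ r ≤ suc m ∸ r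
    later = ℕP.∸-monoˡ-≤ r (ℕP.n≤1+n m)
  ... | inj₂ (a≡1 , r≤m) | W-bound , N-bound rewrite a≡1 | ℕP.+-∸-assoc 1 r≤m =
      occupied-step (Σ<ℕ m (λ t → a t * flowWeight r t)) (Σ<ℕ m a) (m ∸ r) W-bound ,
      subst (Σ<ℕ m a + 1 ≤_) (ℕP.+-comm (m ∸ r) 1) (ℕP.+-monoˡ-≤ 1 N-bound)

  occupied-delay : ∀ t → ⟦ a t ⟧ ℚ.* ((⟦ t ⟧ ℚ.+ ½) ℚ.- ⟦ r ⟧) ≡ ⟦ a t * flowWeight r t ⟧ ℚ.* ½
  occupied-delay t with occ t
  ... | inj₁ a≡0 rewrite a≡0 = trans (ℚP.*-zeroˡ ((⟦ t ⟧ ℚ.+ ½) ℚ.- ⟦ r ⟧)) (sym (ℚP.*-zeroˡ ½))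
  ... | inj₂ (a≡1 , r≤t) rewrite a≡1 = begin
    1ℚ ℚ.* ((⟦ t ⟧ ℚ.+ ½) ℚ.- ⟦ r ⟧)            ≡⟨ cong (λ u → 1ℚ ℚ.* ((u ℚ.+ ½) ℚ.- ⟦ r ⟧)) t≡d+r ⟩
    1ℚ ℚ.* ((⟦ d ⟧ ℚ.+ ⟦ r ⟧ ℚ.+ ½) ℚ.- ⟦ r ⟧)  ≡⟨ half-shift ⟦ d ⟧ ⟦ r ⟧ ⟩
    1ℚ ℚ.* (1ℚ ℚ.+ ⟦ 2 ⟧ ℚ.* ⟦ d ⟧) ℚ.* ½       ≡⟨ cong (ℚ._* ½) weight ⟨
    ⟦ 1 * flowWeight r t ⟧ ℚ.* ½                 ∎
    where
    open ≡-Reasoning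
    d : ℕ
    d = t ∸ r
    t≡d+r : ⟦ t ⟧ ≡ ⟦ d ⟧ ℚ.+ ⟦ r ⟧
    t≡d+r = trans (cong ⟦_⟧ (sym (ℕP.m∸n+n≡m r≤t))) (⟦⟧-homo-+ d r)
    half-shift : ∀ x y → 1ℚ ℚ.* ((x ℚ.+ y ℚ.+ ½) ℚ.- y) ≡ 1ℚ ℚ.* (1ℚ ℚ.+ ⟦ 2 ⟧ ℚ.* x) ℚ.* ½
    half-shift = solve-∀ ℚ-ring
    weight : ⟦ 1 * flowWeight r t ⟧ ≡ 1ℚ ℚ.* (1ℚ ℚ.+ ⟦ 2 ⟧ ℚ.* ⟦ d ⟧)
    weight = trans (⟦⟧-homo-* 1 (1 + 2 * d))
                   (cong (1ℚ ℚ.*_) (trans (⟦⟧-homo-+ 1 (2 * d)) (cong (1ℚ ℚ.+_) (⟦⟧-homo-* 2 d))))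

  occupancy-cost : ∀ c m →
    Σ<ℚ m (λ t → (⟦ a t ⟧ ℚ.* c) ℚ.* ((⟦ t ⟧ ℚ.+ ½) ℚ.- ⟦ r ⟧) ℚ.+ ⟦ a t ⟧ ℚ.* ½)
      ≡ (⟦ Σ<ℕ m (λ t → a t * flowWeight r t) ⟧ ℚ.* c ℚ.+ ⟦ Σ<ℕ m a ⟧) ℚ.* ½
  occupancy-cost c zero = empty c
    where
    empty : ∀ c → 0ℚ ≡ (0ℚ ℚ.* c ℚ.+ 0ℚ) ℚ.* ½
    empty = solve-∀ ℚ-ring
  occupancy-cost c (suc m) = begin
    Σ<ℚ m term ℚ.+ ((A ℚ.* c) ℚ.* X ℚ.+ A ℚ.* ½)
      ≡⟨ cong₂ ℚ._+_ (occupancy-cost c m) (reassociate A c X) ⟩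
    (W ℚ.* c ℚ.+ N) ℚ.* ½ ℚ.+ (c ℚ.* (A ℚ.* X) ℚ.+ A ℚ.* ½)
      ≡⟨ cong (λ u → (W ℚ.* c ℚ.+ N) ℚ.* ½ ℚ.+ (c ℚ.* u ℚ.+ A ℚ.* ½)) (occupied-delay m) ⟩
    (W ℚ.* c ℚ.+ N) ℚ.* ½ ℚ.+ (c ℚ.* (w ℚ.* ½) ℚ.+ A ℚ.* ½)
      ≡⟨ collect W N w A c ⟩
    ((W ℚ.+ w) ℚ.* c ℚ.+ (N ℚ.+ A)) ℚ.* ½
      ≡⟨ cong₂ (λ u v → (u ℚ.* c ℚ.+ v) ℚ.* ½) (⟦⟧-homo-+ (Σ<ℕ m (λ t → a t * flowWeight r t)) (a m * flowWeight r m))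
                                                   (⟦⟧-homo-+ (Σ<ℕ m a) (a m)) ⟨
    (⟦ Σ<ℕ (suc m) (λ t → a t * flowWeight r t) ⟧ ℚ.* c ℚ.+ ⟦ Σ<ℕ (suc m) a ⟧) ℚ.* ½
      ∎
    where
    open ≡-Reasoning
    term : ℕ → ℚ
    term t = (⟦ a t ⟧ ℚ.* c) ℚ.* ((⟦ t ⟧ ℚ.+ ½) ℚ.- ⟦ r ⟧) ℚ.+ ⟦ a t ⟧ ℚ.* ½
    A X W N w : ℚ
    A = ⟦ a m ⟧
    X = (⟦ m ⟧ ℚ.+ ½) ℚ.- ⟦ r ⟧
    W = ⟦ Σ<ℕ m (λ t → a t * flowWeight r t) ⟧
    N = ⟦ Σ<ℕ m a ⟧
    w = ⟦ a m * flowWeight r m ⟧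
    reassociate : ∀ A c X → (A ℚ.* c) ℚ.* X ℚ.+ A ℚ.* ½ ≡ c ℚ.* (A ℚ.* X) ℚ.+ A ℚ.* ½
    reassociate = solve-∀ ℚ-ring
    collect : ∀ W N w A c →
      (W ℚ.* c ℚ.+ N) ℚ.* ½ ℚ.+ (c ℚ.* (w ℚ.* ½) ℚ.+ A ℚ.* ½) ≡ ((W ℚ.+ w) ℚ.* c ℚ.+ (N ℚ.+ A)) ℚ.* ½
    collect = solve-∀ ℚ-ring

n≤2^⌈log₂n⌉ : ∀ n → n ≤ 2 ^ ⌈log₂ n ⌉
n≤2^⌈log₂n⌉ n = bound n (<-wellFounded n)
  where
  open ℕP.≤-Reasoning
  n≤2*⌈n/2⌉ : ∀ n → n ≤ 2 * ⌈ n /2⌉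
  n≤2*⌈n/2⌉ n = begin
    n                   ≡⟨ ℕP.⌊n/2⌋+⌈n/2⌉≡n n ⟨
    ⌊ n /2⌋ + ⌈ n /2⌉   ≤⟨ ℕP.+-monoˡ-≤ ⌈ n /2⌉ (ℕP.⌊n/2⌋≤⌈n/2⌉ n) ⟩
    ⌈ n /2⌉ + ⌈ n /2⌉   ≡⟨ cong (_+_ ⌈ n /2⌉) (ℕP.+-identityʳ ⌈ n /2⌉) ⟨
    2 * ⌈ n /2⌉         ∎
  bound : ∀ n (rec : Acc _<_ n) → n ≤ 2 ^ ⌈log2⌉ n rec
  bound zero          _        = z≤n
  bound (suc zero)    _        = s≤s z≤n
  bound (suc (suc n)) (acc rs) = begin
    2 + n                  ≤⟨ s≤s (s≤s (n≤2*⌈n/2⌉ n)) ⟩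
    2 + 2 * ⌈ n /2⌉        ≡⟨ ℕP.*-suc 2 ⌈ n /2⌉ ⟨
    2 * suc ⌈ n /2⌉        ≤⟨ ℕP.*-monoʳ-≤ 2 (bound (suc ⌈ n /2⌉) (rs _)) ⟩
    2 * 2 ^ ⌈log2⌉ (suc ⌈ n /2⌉) (rs _) ∎

rounding-bound : ∀ W p q D → W + p * p ≤ 2 * p * D → p ≤ D → p ≤ q → W + p * q ≤ 2 * q * D
rounding-bound W p q D W-bound p≤D p≤q =
  subst₂ (λ q D → W + p * q ≤ 2 * q * D) (ℕP.m+[n∸m]≡n p≤q) (ℕP.m+[n∸m]≡n p≤D)
    (shifted (q ∸ p) (D ∸ p) (subst (λ D → W + p * p ≤ 2 * p * D) (sym (ℕP.m+[n∸m]≡n p≤D)) W-bound))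
  where
  shifted : ∀ e g → W + p * p ≤ 2 * p * (p + g) → W + p * (p + e) ≤ 2 * (p + e) * (p + g)
  shifted e g bound = begin
    W + p * (p + e)                                ≡⟨ solve (W ∷ p ∷ e ∷ []) ⟩
    W + p * p + p * e                              ≤⟨ ℕP.+-monoˡ-≤ (p * e) bound ⟩
    2 * p * (p + g) + p * e                        ≤⟨ ℕP.m≤m+n (2 * p * (p + g) + p * e) (p * e + 2 * e * g) ⟩
    2 * p * (p + g) + p * e + (p * e + 2 * e * g)  ≡⟨ solve (p ∷ e ∷ g ∷ []) ⟩
    2 * (p + e) * (p + g)                          ∎
    where open ℕP.≤-Reasoning

cost-≤ : ∀ W N D m .{{_ : NonZero m}} → W + N * m ≤ 2 * m * D →
         (⟦ W ⟧ ℚ.* (+ 1 / m) ℚ.+ ⟦ N ⟧) ℚ.* ½ ℚ.≤ ⟦ D ⟧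
cost-≤ W N D m@(suc _) bound = ℚP.*-cancelʳ-≤-pos ⟦ 2 * m ⟧ {{ℚP.normalize-pos (2 * m) 1}} (begin
  (⟦ W ⟧ ℚ.* (+ 1 / m) ℚ.+ ⟦ N ⟧) ℚ.* ½ ℚ.* ⟦ 2 * m ⟧
    ≡⟨ cong (λ u → (⟦ W ⟧ ℚ.* (+ 1 / m) ℚ.+ ⟦ N ⟧) ℚ.* ½ ℚ.* u) (⟦⟧-homo-* 2 m) ⟩
  (⟦ W ⟧ ℚ.* (+ 1 / m) ℚ.+ ⟦ N ⟧) ℚ.* ½ ℚ.* (⟦ 2 ⟧ ℚ.* ⟦ m ⟧)
    ≡⟨ clear-half ⟦ W ⟧ (+ 1 / m) ⟦ N ⟧ ⟦ m ⟧ ⟩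
  ⟦ W ⟧ ℚ.* ((+ 1 / m) ℚ.* ⟦ m ⟧) ℚ.+ ⟦ N ⟧ ℚ.* ⟦ m ⟧
    ≡⟨ cong (λ u → ⟦ W ⟧ ℚ.* u ℚ.+ ⟦ N ⟧ ℚ.* ⟦ m ⟧) (1/n*n≡1 m) ⟩
  ⟦ W ⟧ ℚ.* 1ℚ ℚ.+ ⟦ N ⟧ ℚ.* ⟦ m ⟧
    ≡⟨ cong₂ ℚ._+_ (ℚP.*-identityʳ ⟦ W ⟧) (sym (⟦⟧-homo-* N m)) ⟩
  ⟦ W ⟧ ℚ.+ ⟦ N * m ⟧
    ≡⟨ ⟦⟧-homo-+ W (N * m) ⟨
  ⟦ W + N * m ⟧
    ≤⟨ ⟦⟧-mono-≤ (subst (W + N * m ≤_) (ℕP.*-comm (2 * m) D) bound) ⟩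
  ⟦ D * (2 * m) ⟧
    ≡⟨ ⟦⟧-homo-* D (2 * m) ⟩
  ⟦ D ⟧ ℚ.* ⟦ 2 * m ⟧ ∎)
  where
  open ℚP.≤-Reasoning
  clear-half : ∀ W i N m → (W ℚ.* i ℚ.+ N) ℚ.* ½ ℚ.* (⟦ 2 ⟧ ℚ.* m) ≡ W ℚ.* (i ℚ.* m) ℚ.+ N ℚ.* m
  clear-half = solve-∀ ℚ-ring

module _ {n} {r p : Fin n → ℕ} {Π : ℚ} {σ : Schedule n} (feasible : Feasible r p Π σ) where
  open Schedule σ
  open Feasible feasible

  occupancy : Fin n → ℕ → ℕ
  occupancy j t = runs (slot t) j

  weighted : Fin n → ℕ → ℕ
  weighted j t = occupancy j t * flowWeight (r j) t

  jobFlow : Fin n → ℕ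
  jobFlow j = if lookup S j then C j ∸ r j else 0

  occupancy-released : ∀ j → Occupancy (r j) (occupancy j)
  occupancy-released j t with runs-01 (slot t) j
  ... | inj₁ idle             = inj₁ idle
  ... | inj₂ (busy , slot≡j) = inj₂ (busy , afterRelease t j slot≡j)

  occupancy-completed : ∀ j t → C j ≤ t → occupancy j t ≡ 0
  occupancy-completed j t C≤t = runs-idle (λ slot≡j → ℕP.<⇒≱ (beforeCompl t j slot≡j) C≤t)

  occupancy-unselected : ∀ j → lookup S j ≡ false → ∀ t → occupancy j t ≡ 0
  occupancy-unselected j unselected t = runs-idle unscheduled
    where
    unscheduled : slot t ≢ just j
    unscheduled slot≡j with trans (sym ([]=⇒lookup (onlySelected t j slot≡j))) unselected
    ... | ()

  Σ<ℕ-occupancy : ∀ j → j ∈ S → Σ<ℕ (C j) (occupancy j) ≡ p j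
  Σ<ℕ-occupancy j j∈S = trans (sym (count≡Σ<ℕ-runs slot j (C j))) (fullAmount j j∈S)

  scheduleLP : ℕ → LPSol n
  scheduleLP T = record
    { x = λ j t → ⟦ occupancy j t ⟧
    ; y = λ j → ⟦ indicator S j ⟧
    ; f = λ j → Σ<ℚ (suc T) (λ t →
            (⟦ occupancy j t ⟧ ℚ.* inv-p̃ (p j)) ℚ.* ((⟦ t ⟧ ℚ.+ ½) ℚ.- ⟦ r j ⟧) ℚ.+ ⟦ occupancy j t ⟧ ℚ.* ½)
    }

  module _ {T : ℕ} (done : CompletesBy σ T) where

    horizon : ∀ j → j ∈ S → (g : ℕ → ℕ) → (∀ t → C j ≤ t → g t ≡ 0) → Σ<ℕ (suc T) g ≡ Σ<ℕ (C j) g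
    horizon j j∈S g = Σ<ℕ-stable g (ℕP.m≤n⇒m≤1+n (done j j∈S))

    work-done : ∀ j → Σ<ℕ (suc T) (occupancy j) ≡ p j * indicator S j
    work-done j with lookup S j in selected
    ... | true  = begin
      Σ<ℕ (suc T) (occupancy j)  ≡⟨ horizon j j∈S (occupancy j) (occupancy-completed j) ⟩
      Σ<ℕ (C j) (occupancy j)    ≡⟨ Σ<ℕ-occupancy j j∈S ⟩
      p j                        ≡⟨ ℕP.*-identityʳ (p j) ⟨
      p j * 1                    ∎
      where
      open ≡-Reasoning
      j∈S : j ∈ S
      j∈S = lookup⇒[]= j S selected
    ... | false = trans (Σ<ℕ-stable (occupancy j) z≤n (λ t _ → occupancy-unselected j selected t))
                        (sym (ℕP.*-zeroʳ (p j)))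

    cost-bound : ∀ j → Σ<ℕ (suc T) (weighted j) + Σ<ℕ (suc T) (occupancy j) * p̃ (p j) ≤ 2 * p̃ (p j) * jobFlow j
    cost-bound j with lookup S j in selected
    ... | true  = begin
      Σ<ℕ (suc T) (weighted j) + Σ<ℕ (suc T) (occupancy j) * p̃ (p j)
        ≡⟨ cong₂ (λ u v → u + v * p̃ (p j)) (horizon j j∈S (weighted j) weighted-completed)
                                              (horizon j j∈S (occupancy j) (occupancy-completed j)) ⟩
      Σ<ℕ (C j) (weighted j) + Σ<ℕ (C j) (occupancy j) * p̃ (p j)
        ≡⟨ cong (λ v → Σ<ℕ (C j) (weighted j) + v * p̃ (p j)) (Σ<ℕ-occupancy j j∈S) ⟩
      Σ<ℕ (C j) (weighted j) + p j * p̃ (p j)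
        ≤⟨ rounding-bound _ (p j) (p̃ (p j)) (C j ∸ r j) (proj₁ bounds) (proj₂ bounds) (n≤2^⌈log₂n⌉ (p j)) ⟩
      2 * p̃ (p j) * (C j ∸ r j) ∎
      where
      open ℕP.≤-Reasoning
      j∈S : j ∈ S
      j∈S = lookup⇒[]= j S selected
      weighted-completed : ∀ t → C j ≤ t → weighted j t ≡ 0
      weighted-completed t C≤t = cong (_* flowWeight (r j) t) (occupancy-completed j t C≤t)
      bounds : Σ<ℕ (C j) (weighted j) + p j * p j ≤ 2 * p j * (C j ∸ r j) × p j ≤ C j ∸ r j
      bounds = subst (λ N → Σ<ℕ (C j) (weighted j) + N * N ≤ 2 * N * (C j ∸ r j) × N ≤ C j ∸ r j)
                     (Σ<ℕ-occupancy j j∈S) (occupancy-bound (occupancy-released j) (C j))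
    ... | false = begin
      Σ<ℕ (suc T) (weighted j) + Σ<ℕ (suc T) (occupancy j) * p̃ (p j)
        ≡⟨ cong₂ (λ u v → u + v * p̃ (p j)) (vanish (weighted j) weighted-idle) (vanish (occupancy j) idle) ⟩
      0
        ≤⟨ z≤n ⟩
      2 * p̃ (p j) * 0 ∎
      where
      open ℕP.≤-Reasoning
      idle : ∀ t → occupancy j t ≡ 0
      idle = occupancy-unselected j selected
      weighted-idle : ∀ t → weighted j t ≡ 0
      weighted-idle t = cong (_* flowWeight (r j) t) (idle t)
      vanish : ∀ g → (∀ t → g t ≡ 0) → Σ<ℕ (suc T) g ≡ 0
      vanish g g≡0 = Σ<ℕ-stable g z≤n (λ t _ → g≡0 t)

    scheduleLP-feasible : LPFeasible r p Π T (scheduleLP T)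
    scheduleLP-feasible = record
      { c1  = λ j → refl
      ; c2  = λ j → begin
          ⟦ p j ⟧ ℚ.* ⟦ indicator S j ⟧          ≡⟨ ⟦⟧-homo-* (p j) (indicator S j) ⟨
          ⟦ p j * indicator S j ⟧                ≡⟨ cong ⟦_⟧ (work-done j) ⟨
          ⟦ Σ<ℕ (suc T) (occupancy j) ⟧          ≡⟨ Σ<ℚ-⟦⟧ (suc T) (occupancy j) ⟨
          Σ<ℚ (suc T) (λ t → ⟦ occupancy j t ⟧)  ∎
      ; c3  = λ t _ → subst (ℚ._≤ 1ℚ) (sym (Σℚ-⟦⟧ (λ j → occupancy j t))) (⟦⟧-mono-≤ (Σℕ-runs≤1 (slot t)))
      ; c4  = subst (Π ℚ.≤_) (trans (cong ⟦_⟧ (sym (Σℕ-indicator S))) (sym (Σℚ-⟦⟧ (indicator S)))) enoughJobs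
      ; c5  = λ j t _ t<r → cong ⟦_⟧ (runs-idle (λ slot≡j → ℕP.<⇒≱ t<r (afterRelease t j slot≡j)))
      ; c6x = λ j t _ → ⟦⟧-mono-≤ {0} {occupancy j t} z≤n
      ; c6y = λ j → ⟦⟧-mono-≤ {0} {indicator S j} z≤n , ⟦⟧-mono-≤ (indicator≤1 S j)
      }
      where open ≡-Reasoning

    scheduleLP-objective : LPObjective (scheduleLP T) ℚ.≤ ⟦ flowTime r σ ⟧
    scheduleLP-objective = subst (LPObjective (scheduleLP T) ℚ.≤_) (Σℚ-⟦⟧ jobFlow) (Σℚ-mono-≤ job-cost-≤)
      where
      job-cost-≤ : ∀ j → LPSol.f (scheduleLP T) j ℚ.≤ ⟦ jobFlow j ⟧
      job-cost-≤ j = subst (ℚ._≤ ⟦ jobFlow j ⟧)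
        (sym (occupancy-cost (occupancy-released j) (inv-p̃ (p j)) (suc T)))
        (cost-≤ (Σ<ℕ (suc T) (weighted j)) (Σ<ℕ (suc T) (occupancy j)) (jobFlow j) (p̃ (p j))
                {{ℕP.m^n≢0 2 (expo (p j))}} (cost-bound j))

lemma4p1 : (n : ℕ) (r p : Fin n → ℕ) → (∀ j → 0 < p j) →
             (Π : ℚ) → 0ℚ ℚ.< Π → (T : ℕ) →
             (σ : Schedule n) → Optimal r p Π σ → CompletesBy σ T →
             Σ (LPSol n) (λ s → LPFeasible r p Π T s × (LPObjective s ℚ.≤ ⟦ flowTime r σ ⟧))
lemma4p1 n r p _ Π _ T σ (feasible , _) done =
  scheduleLP feasible T , scheduleLP-feasible feasible done , scheduleLP-objective feasible done
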